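{- For integers $1 \leq t \leq n$ and $q \geq 2$, \[ \mathsf{SAN}(t,n,q) \leq \mathsf{CAN}(t,n,q) + 1 - (q-1)^t. \]
   Context: Let $\mathbb Z_q = \mathbb Z/q\mathbb Z$. For an $n$-tuple $x$ and $T \subseteq \{1,\dots,n\}$, $x_T$ denotes the $|T|$-tuple obtained by keeping only the coordinates indexed by $T$. Two $t$-tuples are at maximum distance if they differ in all $t$ coordinates. An $N \times n$ array $M$ with entries in $\mathbb Z_q$ is a skirting array of strength $t$, written $\mathsf{SA}(N;t,n,q)$, if for every $t$-subset $T \subseteq \{1,\dots,n\}$ and every $y \in \mathbb Z_q^t$ there is a row $x$ of $M$ such that $x_T$ differs from $y$ in every coordinate. $\mathsf{SAN}(t,n,q)$ is the smallest $N$ for which an $\mathsf{SA}(N;t,n,q)$ exists. A covering array $\mathsf{CA}(N;t,n,q)$ is an $N\times n$ array over an alphabet of size $q$ such that for every $t$ columns, every $t$-tuple over the alphabet appears at least once as a row of the $N \times t$ restriction; $\mathsf{CAN}(t,n,q)$ is the smallest such $N$. -}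

module Defs where

open import Data.Nat using (ℕ; _≤_)
open import Data.Fin using (Fin; _<_)
open import Data.Product using (∃)
open import Relation.Binary.PropositionalEquality using (_≡_; _≢_)

Array : ℕ → ℕ → ℕ → Set
Array N n q = Fin N → Fin n → Fin q

-- A t-subset T of the column set {1..n}, listed in increasing order
-- (a strictly increasing map Fin t → Fin n); x_T is then  λ i → x (T i).
StrictlyIncreasing : ∀ {t n} → (Fin t → Fin n) → Set
StrictlyIncreasing T = ∀ i j → i < j → T i < T j

IsSkirtingArray : (N t n q : ℕ) → Array N n q → Set
IsSkirtingArray N t n q M =
  ∀ (T : Fin t → Fin n) → StrictlyIncreasing T →
  ∀ (y : Fin t → Fin q) → ∃ λ (r : Fin N) → ∀ (i : Fin t) → M r (T i) ≢ y i

IsCoveringArray : (N t n q : ℕ) → Array N n q → Set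
IsCoveringArray N t n q M =
  ∀ (T : Fin t → Fin n) → StrictlyIncreasing T →
  ∀ (y : Fin t → Fin q) → ∃ λ (r : Fin N) → ∀ (i : Fin t) → M r (T i) ≡ y i

SAExists : (N t n q : ℕ) → Set
SAExists N t n q = ∃ λ (M : Array N n q) → IsSkirtingArray N t n q M

CAExists : (N t n q : ℕ) → Set
CAExists N t n q = ∃ λ (M : Array N n q) → IsCoveringArray N t n q M

IsSAN : (t n q m : ℕ) → Set
IsSAN t n q m = SAExists m t n q × (∀ N → SAExists N t n q → m ≤ N)
  where open import Data.Product using (_×_)

IsCAN : (t n q m : ℕ) → Set
IsCAN t n q m = CAExists m t n q × (∀ N → CAExists N t n q → m ≤ N)
  where open import Data.Product using (_×_)

module Submission where

open import Defs
open import Data.Nat using (ℕ; zero; suc; pred; _≤_; _<_; _+_; _^_; _∸_; s≤s; _≤?_; NonZero; >-nonZero)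
open import Data.Nat.Properties
  using (≤-trans; <⇒≤; <⇒≱; ≰⇒>; +-suc; +-comm; ∸-monoˡ-<; m∸n+n≡m; m≤o∸n⇒m+n≤o; ^-monoˡ-≤; n≤1+n;
         suc-pred; ≤-reflexive; m^n>0; module ≤-Reasoning)
open import Data.Fin as Fin using (Fin; toℕ; fromℕ<; inject≤; punchIn; combine; finToFun; funToFin)
open import Data.Fin.Properties
  using (toℕ-injective; toℕ-fromℕ<; fromℕ<-injective; toℕ-inject≤; toℕ<n; punchInᵢ≢i; punchIn-injective;
         funToFin-finToFin; injective⇒≤; any?)
open import Data.Product using (∃; _,_; proj₁; proj₂)
open import Function using (_∘_; Injective)
open import Relation.Binary.PropositionalEquality
open import Relation.Nullary using (yes; no; contradiction)

-- Distinct tuples are covered by distinct rows of a covering array, so the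
-- (q-1)^t tuples at maximum distance from y occupy (q-1)^t distinct rows, all of
-- which skirt y. Deleting any (q-1)^t - 1 rows (here the first ones) therefore
-- leaves a row skirting y, for every choice of columns and of y.

funToFin-cong : ∀ {m n} {f g : Fin m → Fin n} → f ≗ g → funToFin f ≡ funToFin g
funToFin-cong {zero}  _   = refl
funToFin-cong {suc m} f≗g = cong₂ combine (f≗g Fin.zero) (funToFin-cong (f≗g ∘ Fin.suc))

finToFun-injective : ∀ {m n} {a b : Fin (m ^ n)} → finToFun {m} {n} a ≗ finToFun b → a ≡ b
finToFun-injective {m} {n} {a} {b} eq = begin
  a                              ≡⟨ funToFin-finToFin {n} {m} a ⟨
  funToFin (finToFun {m} {n} a)  ≡⟨ funToFin-cong eq ⟩
  funToFin (finToFun {m} {n} b)  ≡⟨ funToFin-finToFin {n} {m} b ⟩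
  b                              ∎
  where open ≡-Reasoning

injective⇒∃≥ : ∀ {k N d} {f : Fin k → Fin N} → Injective _≡_ _≡_ f →
               d < k → ∃ λ a → d ≤ toℕ (f a)
injective⇒∃≥ {k} {d = d} {f} f-injective d<k with any? (λ a → d ≤? toℕ (f a))
... | yes found = found
... | no none = contradiction (injective⇒≤ below-injective) (<⇒≱ d<k)
  where
  below : Fin k → Fin d
  below a = fromℕ< (≰⇒> (none ∘ (a ,_)))

  below-injective : Injective _≡_ _≡_ below
  below-injective eq = f-injective (toℕ-injective (fromℕ<-injective _ _ _ _ eq))

firstColumns : ∀ {t n} → t ≤ n → Fin t → Fin n
firstColumns t≤n i = inject≤ i t≤n

firstColumns-increasing : ∀ {t n} (t≤n : t ≤ n) → StrictlyIncreasing (firstColumns t≤n)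
firstColumns-increasing t≤n i j i<j =
  subst₂ _<_ (sym (toℕ-inject≤ i t≤n)) (sym (toℕ-inject≤ j t≤n)) i<j

dropRows : ∀ {N n q d} → d ≤ N → Array N n q → Array (N ∸ d) n q
dropRows d≤N M s = M (fromℕ< (m≤o∸n⇒m+n≤o (suc (toℕ s)) d≤N (toℕ<n s)))

dropRows-keeps : ∀ {N n q d} (d≤N : d ≤ N) (M : Array N n q) (r : Fin N) →
                 d ≤ toℕ r → ∃ λ s → dropRows d≤N M s ≡ M r
dropRows-keeps {N} {d = d} d≤N M r d≤r = s , cong M (toℕ-injective shift-s≡r)
  where
  r∸d<N∸d : toℕ r ∸ d < N ∸ d
  r∸d<N∸d = ∸-monoˡ-< (toℕ<n r) d≤r

  s : Fin (N ∸ d)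
  s = fromℕ< r∸d<N∸d

  shift-s≡r : toℕ (fromℕ< _) ≡ toℕ r
  shift-s≡r = begin
    toℕ (fromℕ< _)  ≡⟨ toℕ-fromℕ< _ ⟩
    toℕ s + d       ≡⟨ cong (_+ d) (toℕ-fromℕ< r∸d<N∸d) ⟩
    toℕ r ∸ d + d   ≡⟨ m∸n+n≡m d≤r ⟩
    toℕ r           ∎
    where open ≡-Reasoning

module _ {N t n q} (M : Array N n q) (ca : IsCoveringArray N t n q M)
         {T : Fin t → Fin n} (increasing : StrictlyIncreasing T) where

  coveringRow : (Fin t → Fin q) → Fin N
  coveringRow y = proj₁ (ca T increasing y)

  coveringRow-covers : ∀ y i → M (coveringRow y) (T i) ≡ y i
  coveringRow-covers y = proj₂ (ca T increasing y)

  coveringRow-injective : ∀ {y z} → coveringRow y ≡ coveringRow z → y ≗ z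
  coveringRow-injective {y} {z} eq i = begin
    y i                      ≡⟨ coveringRow-covers y i ⟨
    M (coveringRow y) (T i)  ≡⟨ cong (λ r → M r (T i)) eq ⟩
    M (coveringRow z) (T i)  ≡⟨ coveringRow-covers z i ⟩
    z i                      ∎
    where open ≡-Reasoning

module _ {N t n m} (M : Array N n (suc m)) (ca : IsCoveringArray N t n (suc m) M)
         {T : Fin t → Fin n} (increasing : StrictlyIncreasing T) (y : Fin t → Fin (suc m)) where

  -- Tuples at maximum distance from y are numbered by Fin (m ^ t): digit i of a
  -- is read as a symbol of Fin (suc m) with y i punched out.
  skirtingRow : Fin (m ^ t) → Fin N
  skirtingRow a = coveringRow M ca increasing (λ i → punchIn (y i) (finToFun {m} {t} a i))

  skirtingRow-skirts : ∀ a i → M (skirtingRow a) (T i) ≢ y i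
  skirtingRow-skirts a i eq =
    punchInᵢ≢i (y i) (finToFun {m} {t} a i) (trans (sym (coveringRow-covers M ca increasing _ i)) eq)

  skirtingRow-injective : Injective _≡_ _≡_ skirtingRow
  skirtingRow-injective eq = finToFun-injective λ i →
    punchIn-injective (y i) _ _ (coveringRow-injective M ca increasing eq i)

coveringArray-size : ∀ {N t n q} (M : Array N n q) → IsCoveringArray N t n q M → t ≤ n → q ^ t ≤ N
coveringArray-size {t = t} {q = q} M ca t≤n =
  injective⇒≤ {f = coveringRow M ca (firstColumns-increasing t≤n) ∘ finToFun {q} {t}}
    (finToFun-injective ∘ coveringRow-injective M ca (firstColumns-increasing t≤n))

covering⇒skirting-dropRows : ∀ {N t n m d} (M : Array N n (suc m)) →
  IsCoveringArray N t n (suc m) M → (d≤N : d ≤ N) → d < m ^ t →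
  IsSkirtingArray (N ∸ d) t n (suc m) (dropRows d≤N M)
covering⇒skirting-dropRows M ca d≤N d<mᵗ T increasing y =
  let a , d≤row = injective⇒∃≥ (skirtingRow-injective M ca increasing y) d<mᵗ
      s , kept  = dropRows-keeps d≤N M _ d≤row
  in  s , λ i → subst (λ row → row (T i) ≢ y i) (sym kept) (skirtingRow-skirts M ca increasing y a i)

m≤n∸o⇒m+suc[o]≤n+1 : ∀ m n o → o ≤ n → m ≤ n ∸ o → m + suc o ≤ n + 1
m≤n∸o⇒m+suc[o]≤n+1 m n o o≤n m≤n∸o = begin
  m + suc o    ≡⟨ +-suc m o ⟩
  suc (m + o)  ≤⟨ s≤s (m≤o∸n⇒m+n≤o m o≤n m≤n∸o) ⟩
  suc n        ≡⟨ +-comm 1 n ⟩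
  n + 1        ∎
  where open ≤-Reasoning

lemma4p1 : ∀ (t n q : ℕ) → 1 ≤ t → t ≤ n → 2 ≤ q →
    ∀ (san can : ℕ) → IsSAN t n q san → IsCAN t n q can →
    san + (q ∸ 1) ^ t ≤ can + 1
lemma4p1 t n (suc zero) _ _ (s≤s ()) _ _ _ _
lemma4p1 t n (suc (suc p)) _ t≤n _ san can (_ , san-least) ((M , ca) , _) =
  subst (λ k → san + k ≤ can + 1) (suc-pred k)
    (m≤n∸o⇒m+suc[o]≤n+1 san can d d≤can san≤can∸d)
  where
  k : ℕ
  k = suc p ^ t

  instance
    k-nonZero : NonZero k
    k-nonZero = >-nonZero (m^n>0 (suc p) t)

  d : ℕ
  d = pred k

  d<k : d < k
  d<k = ≤-reflexive (suc-pred k)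

  d≤can : d ≤ can
  d≤can = ≤-trans (<⇒≤ d<k) (≤-trans (^-monoˡ-≤ t (n≤1+n (suc p))) (coveringArray-size M ca t≤n))

  san≤can∸d : san ≤ can ∸ d
  san≤can∸d = san-least (can ∸ d) (dropRows d≤can M , covering⇒skirting-dropRows M ca d≤can d<k)
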